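{- Let $H$ be a factor-critical triangle-free graph. Then $|E(H)|\le 1+\nu(H)^2$.
   Context: All graphs are finite, simple and undirected. A graph is triangle-free if it has no three pairwise adjacent vertices. $\nu(H)$ is the matching number of $H$. A graph $H$ is factor-critical if $H-v$ has a perfect matching for every vertex $v$. -}

module Defs where

open import Data.Nat using (ℕ; _<_; _<?_; _≤_)
open import Data.Fin using (Fin; toℕ)
open import Data.Product using (_×_; _,_; proj₁; proj₂; ∃)
open import Data.List using (List; []; _∷_; length; filter; allFin; cartesianProduct; concatMap)
open import Data.List.Relation.Unary.All using (All)
open import Data.List.Relation.Unary.Unique.Propositional using (Unique)
open import Data.List.Membership.Propositional using (_∈_)
open import Relation.Nullary using (¬_; Dec)
open import Relation.Nullary.Decidable using (_×-dec_)
open import Relation.Binary.PropositionalEquality using (_≡_)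
open import Data.Empty using (⊥)

record Graph : Set₁ where
  field
    n      : ℕ
    Adj    : Fin n → Fin n → Set
    adj?   : ∀ u v → Dec (Adj u v)
    sym    : ∀ {u v} → Adj u v → Adj v u
    irrefl : ∀ {u} → ¬ Adj u u

module _ (G : Graph) where
  open Graph G

  edges : List (Fin n × Fin n)
  edges = filter (λ p → (toℕ (proj₁ p) <? toℕ (proj₂ p)) ×-dec adj? (proj₁ p) (proj₂ p))
                 (cartesianProduct (allFin n) (allFin n))

  numEdges : ℕ
  numEdges = length edges

  TriangleFree : Set
  TriangleFree = ∀ a b c → Adj a b → Adj b c → Adj a c → ⊥

  verts : List (Fin n × Fin n) → List (Fin n)
  verts = concatMap (λ p → proj₁ p ∷ proj₂ p ∷ [])

  IsMatching : List (Fin n × Fin n) → Set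
  IsMatching M = All (λ p → Adj (proj₁ p) (proj₂ p)) M × Unique (verts M)

  -- a matching of maximum size; ν(G) is the length of any such matching
  IsMaximumMatching : List (Fin n × Fin n) → Set
  IsMaximumMatching M = IsMatching M × (∀ M' → IsMatching M' → length M' ≤ length M)

  IsPerfectMatchingMinus : Fin n → List (Fin n × Fin n) → Set
  IsPerfectMatchingMinus v M =
    IsMatching M × ¬ (v ∈ verts M) × (∀ w → ¬ (w ≡ v) → w ∈ verts M)

  FactorCritical : Set
  FactorCritical = ∀ v → ∃ (IsPerfectMatchingMinus v)

module Submission where

-- A factor-critical graph H on n vertices satisfies n ≤ 2ν + 1, since deleting a vertex leaves a
-- perfect matching. If H has an edge uw, following the perfect matchings of H − w and H − u
-- alternately from u must close an odd walk, so H has odd closed walks; take a shortest one. As H is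
-- triangle-free it has length at least 5, its first five vertices w₀, …, w₄ are distinct, and every
-- vertex has at most two neighbours among them: two consecutive ones would span a triangle, and w₀
-- together with w₄ would give a shorter odd closed walk. Writing R for the other n − 5 vertices,
-- counting degrees gives |E| ≤ n + |R| + e(R), and Mantel's theorem 4 e(R) ≤ |R|² together with
-- n = 5 + |R| ≤ 2ν + 1 yields |E| ≤ ν² + 1.

open import Defs
open import Axiom.UniquenessOfIdentityProofs using (module Decidable⇒UIP)
open import Data.Bool using (Bool; true; false; not; _∨_)
open import Data.Empty using (⊥; ⊥-elim)
open import Data.Fin using (Fin; zero; suc; toℕ)
open import Data.Fin.Properties using (_≟_; toℕ-injective)
open import Data.List using (List; []; _∷_; length; map; filter; tabulate; cartesianProduct; _++_; allFin)
open import Data.List.Properties using (map-++; map-∘)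
open import Data.List.Membership.Propositional using (_∈_; _∉_)
open import Data.List.Membership.Propositional.Properties using (∈-filter⁻)
import Data.List.Membership.DecPropositional as DecMembership
import Data.List.Membership.Setoid.Properties as SetoidMembership
open import Data.List.Relation.Unary.All using (All; []; _∷_)
open import Data.List.Relation.Unary.All.Properties using (¬Any⇒All¬)
open import Data.List.Relation.Unary.Any using (here; there)
open import Data.List.Relation.Unary.Unique.Propositional using (Unique; []; _∷_)
open import Data.List.Relation.Unary.Unique.Propositional.Properties using (Unique[x∷xs]⇒x∉xs)
open import Data.Nat using (ℕ; zero; suc; _≤_; _<_; _+_; _*_; z≤n; s≤s; _≤?_; _<?_; parity)
open import Data.Nat.Induction using (<-rec)
open import Data.Nat.ListAction using (sum)
open import Data.Nat.ListAction.Properties using (sum-++)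
open import Data.Nat.Properties hiding (_≟_)
open import Algebra.Properties.Semiring.Sum +-*-semiring
  using (sum-syntax; sum-replicate-zero; ∑-distrib-+; ∑-comm; *-distribˡ-sum; *-distribʳ-sum; sum-cong-≗)
  renaming (sum to ∑)
open import Data.Nat.Tactic.RingSolver using (solve-∀)
open import Data.Parity.Base using (0ℙ; 1ℙ)
open import Data.Parity.Properties using (suc-homo-⁻¹; ⁻¹-selfInverse)
open import Data.Product using (_×_; _,_; proj₁; proj₂; Σ; ∃)
open import Data.Sum using (_⊎_; inj₁; inj₂; [_,_]′)
open import Function using (_∘_; id)
open import Relation.Binary using (tri<; tri≈; tri>)
open import Relation.Binary.PropositionalEquality
open import Relation.Nullary using (¬_; Dec; yes; no; does)
open import Relation.Nullary.Decidable using (dec-true; dec-false; _×-dec_)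
open import Relation.Unary using (Decidable)

2*m*n≤m²+n² : ∀ m n → 2 * (m * n) ≤ m * m + n * n
2*m*n≤m²+n² m n = [ ordered , swapped ]′ (≤-total m n)
  where
  ordered : ∀ {m n} → m ≤ n → 2 * (m * n) ≤ m * m + n * n
  ordered {m} m≤n with d , refl ← m≤n⇒∃[o]m+o≡n m≤n =
    subst (2 * (m * (m + d)) ≤_) (square-identity m d) (m≤m+n _ (d * d))
    where
    square-identity : ∀ m d → 2 * (m * (m + d)) + d * d ≡ m * m + (m + d) * (m + d)
    square-identity = solve-∀
  swapped : n ≤ m → 2 * (m * n) ≤ m * m + n * n
  swapped n≤m = subst₂ _≤_ (cong (2 *_) (*-comm n m)) (+-comm (n * n) (m * m)) (ordered n≤m)

five-cycle-sum≤2 : ∀ a b c d e → a + b ≤ 1 → b + c ≤ 1 → c + d ≤ 1 → d + e ≤ 1 → e + a ≤ 1 →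
                   a + (b + (c + (d + (e + 0)))) ≤ 2
five-cycle-sum≤2 a b c d e ab bc cd de ea =
  ≤-pred (*-cancelˡ-< 2 _ 3 (s≤s (subst (_≤ 5) (twice-sum a b c d e) edge-sums≤5)))
  where
  edge-sums≤5 : a + b + (b + c) + (c + d) + (d + e) + (e + a) ≤ 5
  edge-sums≤5 = +-mono-≤ (+-mono-≤ (+-mono-≤ (+-mono-≤ ab bc) cd) de) ea
  twice-sum : ∀ a b c d e →
              a + b + (b + c) + (c + d) + (d + e) + (e + a) ≡ 2 * (a + (b + (c + (d + (e + 0)))))
  twice-sum = solve-∀

quadratic-bound : ∀ {e n R m} → 4 * e ≤ 4 * n + 4 * R + R * R → n ≡ 5 + R → n ≤ 1 + 2 * m →
                  e ≤ 1 + m * m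
quadratic-bound {e} {R = R} {m} 4e≤ refl n≤1+2m = *-cancelˡ-≤ 4 (begin
  4 * e                              ≤⟨ 4e≤ ⟩
  4 * (5 + R) + 4 * R + R * R        ≡⟨ complete-square R ⟩
  (4 + R) * (4 + R) + 4              ≤⟨ +-monoˡ-≤ 4 (*-mono-≤ 4+R≤2m 4+R≤2m) ⟩
  2 * m * (2 * m) + 4                ≡⟨ expand m ⟩
  4 * (1 + m * m)                    ∎)
  where
  open ≤-Reasoning
  4+R≤2m : 4 + R ≤ 2 * m
  4+R≤2m = ≤-pred n≤1+2m
  complete-square : ∀ R → 4 * (5 + R) + 4 * R + R * R ≡ (4 + R) * (4 + R) + 4
  complete-square = solve-∀
  expand : ∀ m → 2 * m * (2 * m) + 4 ≡ 4 * (1 + m * m)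
  expand = solve-∀

parity-suc-even : ∀ {k} → parity k ≡ 0ℙ → parity (suc k) ≡ 1ℙ
parity-suc-even {k} even = sym (⁻¹-selfInverse (trans (suc-homo-⁻¹ k) even))

-- A least witness of an undecidable predicate on ℕ cannot be computed; deciding the goal instead
-- lets one assume that the given witness is least.
by-minimal-witness : ∀ {P : ℕ → Set} {B : Set} → Dec B →
                     (∀ {k} → P k → (∀ {j} → j < k → ¬ P j) → B) → ∀ {k} → P k → B
by-minimal-witness (yes b) _ _ = b
by-minimal-witness {P} {B} (no ¬b) from-minimal {k} =
  <-rec (λ k → P k → B) (λ _ smaller pk → from-minimal pk (λ j<k → ¬b ∘ smaller j<k)) k

∑-mono-≤ : ∀ {n} {f g : Fin n → ℕ} → (∀ i → f i ≤ g i) → ∑ f ≤ ∑ g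
∑-mono-≤ {zero}  f≤g = z≤n
∑-mono-≤ {suc n} f≤g = +-mono-≤ (f≤g zero) (∑-mono-≤ (f≤g ∘ suc))

∑-const : ∀ n c → ∑[ i < n ] c ≡ n * c
∑-const zero    c = refl
∑-const (suc n) c = cong (c +_) (∑-const n c)

∑-ones : ∀ n → ∑[ i < n ] 1 ≡ n
∑-ones n = trans (∑-const n 1) (*-identityʳ n)

∑∑-distrib-+ : ∀ {m n} (f g : Fin m → Fin n → ℕ) →
               ∑[ i < m ] ∑[ j < n ] (f i j + g i j) ≡
               ∑[ i < m ] ∑[ j < n ] f i j + ∑[ i < m ] ∑[ j < n ] g i j
∑∑-distrib-+ {n = n} f g =
  trans (sum-cong-≗ (λ i → ∑-distrib-+ (f i) (g i)))
        (∑-distrib-+ (λ i → ∑[ j < n ] f i j) (λ i → ∑[ j < n ] g i j))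

∑*∑ : ∀ {m n} (f : Fin m → ℕ) (g : Fin n → ℕ) → ∑ f * ∑ g ≡ ∑[ i < m ] ∑[ j < n ] (f i * g j)
∑*∑ f g = trans (*-distribʳ-sum (∑ g) f) (sum-cong-≗ (λ i → *-distribˡ-sum (f i) g))

weighted-cauchy-schwarz : ∀ {n} (w d : Fin n → ℕ) →
  ∑[ i < n ] (w i * d i) * ∑[ i < n ] (w i * d i) ≤ ∑ w * ∑[ i < n ] (w i * d i * d i)
weighted-cauchy-schwarz {n} w d = *-cancelˡ-≤ 2 (begin
  2 * (∑ f * ∑ f)                                   ≡⟨ cong (2 *_) (∑*∑ f f) ⟩
  2 * ∑[ i < n ] ∑[ j < n ] (f i * f j)             ≡⟨ *-distribˡ-sum 2 (λ i → ∑[ j < n ] (f i * f j)) ⟩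
  ∑[ i < n ] (2 * ∑[ j < n ] (f i * f j))
                           ≡⟨ sum-cong-≗ (λ i → *-distribˡ-sum 2 (λ j → f i * f j)) ⟩
  ∑[ i < n ] ∑[ j < n ] (2 * (f i * f j))           ≤⟨ ∑-mono-≤ (λ i → ∑-mono-≤ (pointwise i)) ⟩
  ∑[ i < n ] ∑[ j < n ] (g i * w j + w i * g j)
                           ≡⟨ ∑∑-distrib-+ (λ i j → g i * w j) (λ i j → w i * g j) ⟩
  ∑[ i < n ] ∑[ j < n ] (g i * w j) + ∑[ i < n ] ∑[ j < n ] (w i * g j)
                                                    ≡⟨ cong₂ _+_ (∑*∑ g w) (∑*∑ w g) ⟨
  ∑ g * ∑ w + ∑ w * ∑ g                             ≡⟨ double (∑ g) (∑ w) ⟩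
  2 * (∑ w * ∑ g)                                   ∎)
  where
  open ≤-Reasoning
  f g : Fin n → ℕ
  f i = w i * d i
  g i = w i * d i * d i
  pointwise : ∀ i j → 2 * (f i * f j) ≤ g i * w j + w i * g j
  pointwise i j = subst₂ _≤_ (lhs (w i) (w j) (d i) (d j)) (rhs (w i) (w j) (d i) (d j))
                         (*-monoʳ-≤ (w i * w j) (2*m*n≤m²+n² (d i) (d j)))
    where
    lhs : ∀ a b x y → a * b * (2 * (x * y)) ≡ 2 * (a * x * (b * y))
    lhs = solve-∀
    rhs : ∀ a b x y → a * b * (x * x + y * y) ≡ a * x * x * b + a * (b * y * y)
    rhs = solve-∀
  double : ∀ a b → a * b + b * a ≡ 2 * (b * a)
  double = solve-∀

χ : Bool → ℕ
χ false = 0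
χ true  = 1

χ≤1 : ∀ b → χ b ≤ 1
χ≤1 false = z≤n
χ≤1 true  = ≤-refl

χ-not : ∀ b → χ b + χ (not b) ≡ 1
χ-not false = refl
χ-not true  = refl

χ-∨-exclusive : ∀ a b c → (a ≡ true → b ≡ false) → χ (a ∨ b) * c ≡ χ a * c + χ b * c
χ-∨-exclusive false b c _    = refl
χ-∨-exclusive true  b c a⇒¬b rewrite a⇒¬b refl = sym (+-identityʳ _)

∑-δ : ∀ {n} (x : Fin n) (f : Fin n → ℕ) → ∑[ y < n ] (χ (does (y ≟ x)) * f y) ≡ f x
∑-δ {suc n} zero    f = trans (cong₂ _+_ (+-identityʳ (f zero)) (sum-replicate-zero n)) (+-identityʳ (f zero))
∑-δ {suc n} (suc x) f = ∑-δ x (f ∘ suc)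

_∈ᵇ_ : ∀ {n} → Fin n → List (Fin n) → Bool
y ∈ᵇ xs = does (DecMembership._∈?_ _≟_ y xs)

∈⇒∈ᵇ : ∀ {n} {y : Fin n} {xs} → y ∈ xs → y ∈ᵇ xs ≡ true
∈⇒∈ᵇ {y = y} {xs} = dec-true (DecMembership._∈?_ _≟_ y xs)

∑-indicator-∈ : ∀ {n} {xs : List (Fin n)} → Unique xs → (f : Fin n → ℕ) →
                ∑[ y < n ] (χ (y ∈ᵇ xs) * f y) ≡ sum (map f xs)
∑-indicator-∈ {n} [] f = sum-replicate-zero n
∑-indicator-∈ {n} {x ∷ xs} unique@(_ ∷ unique-xs) f = begin
  ∑[ y < n ] (χ (y ∈ᵇ (x ∷ xs)) * f y)                         ≡⟨ sum-cong-≗ split ⟩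
  ∑[ y < n ] (χ (does (y ≟ x)) * f y + χ (y ∈ᵇ xs) * f y)      ≡⟨ ∑-distrib-+ {n} _ _ ⟩
  ∑[ y < n ] (χ (does (y ≟ x)) * f y) + ∑[ y < n ] (χ (y ∈ᵇ xs) * f y)
                                                   ≡⟨ cong₂ _+_ (∑-δ x f) (∑-indicator-∈ unique-xs f) ⟩
  f x + sum (map f xs)                                         ∎
  where
  open ≡-Reasoning
  exclusive : ∀ y → does (y ≟ x) ≡ true → y ∈ᵇ xs ≡ false
  exclusive y _ with y ≟ x
  ... | yes refl = dec-false (DecMembership._∈?_ _≟_ x xs) (Unique[x∷xs]⇒x∉xs unique)
  split : ∀ y → χ (y ∈ᵇ (x ∷ xs)) * f y ≡ χ (does (y ≟ x)) * f y + χ (y ∈ᵇ xs) * f y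
  split y = χ-∨-exclusive (does (y ≟ x)) (y ∈ᵇ xs) (f y) (exclusive y)

∑-indicator-length : ∀ {n} {xs : List (Fin n)} → Unique xs → ∑[ y < n ] χ (y ∈ᵇ xs) ≡ length xs
∑-indicator-length {n} {xs} unique =
  trans (sum-cong-≗ (λ y → sym (*-identityʳ (χ (y ∈ᵇ xs)))))
        (trans (∑-indicator-∈ unique (λ _ → 1)) (sum-map-1 xs))
  where
  sum-map-1 : ∀ (xs : List (Fin n)) → sum (map (λ _ → 1) xs) ≡ length xs
  sum-map-1 []       = refl
  sum-map-1 (_ ∷ xs) = cong suc (sum-map-1 xs)

unique-length≤ : ∀ {n} {xs : List (Fin n)} → Unique xs → length xs ≤ n
unique-length≤ {n} {xs} unique = begin
  length xs                 ≡⟨ ∑-indicator-length unique ⟨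
  ∑[ y < n ] χ (y ∈ᵇ xs)    ≤⟨ ∑-mono-≤ (λ y → χ≤1 (y ∈ᵇ xs)) ⟩
  ∑[ y < n ] 1              ≡⟨ ∑-ones n ⟩
  n                         ∎
  where open ≤-Reasoning

nonempty⇒∈ : ∀ {A : Set} {xs : List A} → 0 < length xs → ∃ (_∈ xs)
nonempty⇒∈ {xs = x ∷ _} _ = x , here refl

length-filter≡sum : ∀ {A : Set} {P : A → Set} (P? : Decidable P) (xs : List A) →
                    length (filter P? xs) ≡ sum (map (χ ∘ does ∘ P?) xs)
length-filter≡sum P? []       = refl
length-filter≡sum P? (x ∷ xs) with does (P? x)
... | true  = cong suc (length-filter≡sum P? xs)
... | false = length-filter≡sum P? xs

sum-map-cartesianProduct : ∀ {A B : Set} (f : A × B → ℕ) (xs : List A) (ys : List B) →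
  sum (map f (cartesianProduct xs ys)) ≡ sum (map (λ x → sum (map (λ y → f (x , y)) ys)) xs)
sum-map-cartesianProduct f []       ys = refl
sum-map-cartesianProduct f (x ∷ xs) ys = begin
  sum (map f (map (x ,_) ys ++ cartesianProduct xs ys))           ≡⟨ cong sum (map-++ f (map (x ,_) ys) _) ⟩
  sum (map f (map (x ,_) ys) ++ map f (cartesianProduct xs ys))   ≡⟨ sum-++ (map f (map (x ,_) ys)) _ ⟩
  sum (map f (map (x ,_) ys)) + sum (map f (cartesianProduct xs ys))
                  ≡⟨ cong₂ _+_ (cong sum (sym (map-∘ ys))) (sum-map-cartesianProduct f xs ys) ⟩
  sum (map (λ y → f (x , y)) ys) + sum (map (λ x → sum (map (λ y → f (x , y)) ys)) xs) ∎
  where open ≡-Reasoning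

sum-map-tabulate : ∀ {A : Set} {n} (f : A → ℕ) (g : Fin n → A) →
                   sum (map f (tabulate g)) ≡ ∑[ i < n ] f (g i)
sum-map-tabulate {n = zero}  f g = refl
sum-map-tabulate {n = suc n} f g = cong (f (g zero) +_) (sum-map-tabulate f (g ∘ suc))

module _ (G : Graph) where
  open Graph G renaming (sym to adj-sym)

  A : Fin n → Fin n → ℕ
  A x y = χ (does (adj? x y))

  A-sym : ∀ x y → A x y ≡ A y x
  A-sym x y with adj? x y | adj? y x
  ... | yes _  | yes _  = refl
  ... | no _   | no _   = refl
  ... | yes xy | no ¬yx = ⊥-elim (¬yx (adj-sym xy))
  ... | no ¬xy | yes yx = ⊥-elim (¬xy (adj-sym yx))

  A-zero : ∀ {x y} → ¬ Adj x y → A x y ≡ 0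
  A-zero {x} {y} ¬xy with adj? x y
  ... | yes xy = ⊥-elim (¬xy xy)
  ... | no _   = refl

  A+A≤1 : ∀ {x y x′ y′} → (Adj x y → Adj x′ y′ → ⊥) → A x y + A x′ y′ ≤ 1
  A+A≤1 {x} {y} {x′} {y′} not-both with adj? x y | adj? x′ y′
  ... | yes xy | yes x′y′ = ⊥-elim (not-both xy x′y′)
  ... | yes _  | no _     = ≤-refl
  ... | no _   | yes _    = ≤-refl
  ... | no _   | no _     = z≤n

  -- The handshake lemma

  degree : Fin n → ℕ
  degree x = ∑[ y < n ] A x y

  edge? : Decidable (λ (p : Fin n × Fin n) → toℕ (proj₁ p) < toℕ (proj₂ p) × Adj (proj₁ p) (proj₂ p))
  edge? p = (toℕ (proj₁ p) <? toℕ (proj₂ p)) ×-dec adj? (proj₁ p) (proj₂ p)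

  oriented : Fin n → Fin n → ℕ
  oriented u v = χ (does (edge? (u , v)))

  A≡oriented+oriented : ∀ u v → A u v ≡ oriented u v + oriented v u
  A≡oriented+oriented u v with <-cmp (toℕ u) (toℕ v)
  ... | tri< u<v _ v≮u
    rewrite dec-true (toℕ u <? toℕ v) u<v | dec-false (toℕ v <? toℕ u) v≮u = sym (+-identityʳ _)
  ... | tri> u≮v _ v<u
    rewrite dec-false (toℕ u <? toℕ v) u≮v | dec-true (toℕ v <? toℕ u) v<u = A-sym u v
  ... | tri≈ u≮v u≡v v≮u
    rewrite dec-false (toℕ u <? toℕ v) u≮v | dec-false (toℕ v <? toℕ u) v≮u | toℕ-injective u≡v =
    A-zero irrefl

  numEdges≡∑∑oriented : numEdges G ≡ ∑[ u < n ] ∑[ v < n ] oriented u v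
  numEdges≡∑∑oriented = begin
    numEdges G                                  ≡⟨ length-filter≡sum edge? all-pairs ⟩
    sum (map (χ ∘ does ∘ edge?) all-pairs)      ≡⟨ sum-map-cartesianProduct (χ ∘ does ∘ edge?) (allFin n) (allFin n) ⟩
    sum (map row (allFin n))                    ≡⟨ sum-map-tabulate row id ⟩
    ∑[ u < n ] row u                            ≡⟨ sum-cong-≗ (λ u → sum-map-tabulate (oriented u) id) ⟩
    ∑[ u < n ] ∑[ v < n ] oriented u v          ∎
    where
    open ≡-Reasoning
    all-pairs : List (Fin n × Fin n)
    all-pairs = cartesianProduct (allFin n) (allFin n)
    row : Fin n → ℕ
    row u = sum (map (oriented u) (allFin n))

  ∑degree≡2*numEdges : ∑[ x < n ] degree x ≡ 2 * numEdges G
  ∑degree≡2*numEdges = begin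
    ∑[ u < n ] degree u                                 ≡⟨ sum-cong-≗ (sum-cong-≗ ∘ A≡oriented+oriented) ⟩
    ∑[ u < n ] ∑[ v < n ] (oriented u v + oriented v u) ≡⟨ ∑∑-distrib-+ oriented (λ u v → oriented v u) ⟩
    E + ∑[ u < n ] ∑[ v < n ] oriented v u              ≡⟨ cong (E +_) (∑-comm (λ u v → oriented v u)) ⟩
    E + E                                               ≡⟨ cong (E +_) (+-identityʳ E) ⟨
    2 * E                                               ≡⟨ cong (2 *_) numEdges≡∑∑oriented ⟨
    2 * numEdges G                                      ∎
    where
    open ≡-Reasoning
    E : ℕ
    E = ∑[ u < n ] ∑[ v < n ] oriented u v

  edge-exists : 0 < numEdges G → ∃ λ u → ∃ λ w → Adj u w
  edge-exists has-edge with (u , w) , uw∈edges ← nonempty⇒∈ {xs = edges G} has-edge =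
    u , w , proj₂ (proj₂ (∈-filter⁻ edge? {xs = cartesianProduct (allFin n) (allFin n)} uw∈edges))

  -- Mantel's theorem

  deg : (Fin n → ℕ) → Fin n → ℕ
  deg w x = ∑[ y < n ] (w y * A x y)

  -- For w the indicator function of S this is 2 e(G[S]).
  degSum : (Fin n → ℕ) → ℕ
  degSum w = ∑[ x < n ] (w x * deg w x)

  deg+deg≤∑ : TriangleFree G → ∀ w {x y} → Adj x y → deg w x + deg w y ≤ ∑ w
  deg+deg≤∑ triangle-free w {x} {y} xy = begin
    deg w x + deg w y                         ≡⟨ ∑-distrib-+ {n} _ _ ⟨
    ∑[ z < n ] (w z * A x z + w z * A y z)    ≡⟨ sum-cong-≗ (λ z → *-distribˡ-+ (w z) (A x z) (A y z)) ⟨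
    ∑[ z < n ] (w z * (A x z + A y z))        ≤⟨ ∑-mono-≤ (λ z → *-monoʳ-≤ (w z) (no-common-neighbour z)) ⟩
    ∑[ z < n ] (w z * 1)                      ≡⟨ sum-cong-≗ (λ z → *-identityʳ (w z)) ⟩
    ∑ w                                       ∎
    where
    open ≤-Reasoning
    no-common-neighbour : ∀ z → A x z + A y z ≤ 1
    no-common-neighbour z = A+A≤1 (λ xz yz → triangle-free x y z xy yz xz)

  -- The sum Q of w x · (deg w x)² weighs each edge xy by deg w x + deg w y ≤ ∑ w, which bounds 2Q
  -- from above, while Cauchy–Schwarz bounds degSum² by ∑ w · Q.
  mantel : TriangleFree G → ∀ w → 2 * degSum w ≤ ∑ w * ∑ w
  mantel triangle-free w = combine (degSum w) (∑ w) Q (weighted-cauchy-schwarz w (deg w)) 2Q≤degSum*∑w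
    where
    Q : ℕ
    Q = ∑[ x < n ] (w x * deg w x * deg w x)

    ω : Fin n → Fin n → ℕ
    ω x y = w x * w y * A x y

    ω-sym : ∀ x y → ω x y ≡ ω y x
    ω-sym x y = cong₂ _*_ (*-comm (w x) (w y)) (A-sym x y)

    w*deg≡∑ω : ∀ x → w x * deg w x ≡ ∑[ y < n ] ω x y
    w*deg≡∑ω x = trans (*-distribˡ-sum (w x) (λ y → w y * A x y))
                       (sum-cong-≗ (λ y → sym (*-assoc (w x) (w y) (A x y))))

    Q≡∑∑ω*deg-left : Q ≡ ∑[ x < n ] ∑[ y < n ] (ω x y * deg w x)
    Q≡∑∑ω*deg-left = sum-cong-≗ (λ x →
      trans (cong (_* deg w x) (w*deg≡∑ω x)) (*-distribʳ-sum (deg w x) (ω x)))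

    Q≡∑∑ω*deg-right : Q ≡ ∑[ x < n ] ∑[ y < n ] (ω x y * deg w y)
    Q≡∑∑ω*deg-right = trans Q≡∑∑ω*deg-left (trans (∑-comm (λ x y → ω x y * deg w x))
      (sum-cong-≗ (λ x → sum-cong-≗ (λ y → cong (_* deg w y) (ω-sym y x)))))

    pointwise : ∀ x y → ω x y * (deg w x + deg w y) ≤ ω x y * ∑ w
    pointwise x y with adj? x y
    ... | yes xy = *-monoʳ-≤ (w x * w y * 1) (deg+deg≤∑ triangle-free w xy)
    ... | no _   = subst (λ t → t * (deg w x + deg w y) ≤ t * ∑ w) (sym (*-zeroʳ (w x * w y))) z≤n

    2Q≤degSum*∑w : 2 * Q ≤ degSum w * ∑ w
    2Q≤degSum*∑w = begin
      2 * Q                                                     ≡⟨ cong (Q +_) (+-identityʳ Q) ⟩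
      Q + Q                                                     ≡⟨ cong₂ _+_ Q≡∑∑ω*deg-left Q≡∑∑ω*deg-right ⟩
      ∑[ x < n ] ∑[ y < n ] (ω x y * deg w x) + ∑[ x < n ] ∑[ y < n ] (ω x y * deg w y)
                       ≡⟨ ∑∑-distrib-+ (λ x y → ω x y * deg w x) (λ x y → ω x y * deg w y) ⟨
      ∑[ x < n ] ∑[ y < n ] (ω x y * deg w x + ω x y * deg w y)
                       ≡⟨ sum-cong-≗ (λ x → sum-cong-≗ (λ y → *-distribˡ-+ (ω x y) (deg w x) (deg w y))) ⟨
      ∑[ x < n ] ∑[ y < n ] (ω x y * (deg w x + deg w y))       ≤⟨ ∑-mono-≤ (λ x → ∑-mono-≤ (pointwise x)) ⟩
      ∑[ x < n ] ∑[ y < n ] (ω x y * ∑ w)                       ≡⟨ sum-cong-≗ (λ x → *-distribʳ-sum (∑ w) (ω x)) ⟨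
      ∑[ x < n ] (∑[ y < n ] ω x y * ∑ w)                       ≡⟨ *-distribʳ-sum (∑ w) (λ x → ∑[ y < n ] ω x y) ⟨
      ∑[ x < n ] ∑[ y < n ] ω x y * ∑ w                         ≡⟨ cong (_* ∑ w) (sum-cong-≗ w*deg≡∑ω) ⟨
      degSum w * ∑ w                                            ∎
      where open ≤-Reasoning

    combine : ∀ D S Q → D * D ≤ S * Q → 2 * Q ≤ D * S → 2 * D ≤ S * S
    combine zero      S Q _     _     = z≤n
    combine D@(suc _) S Q D²≤SQ 2Q≤DS = *-cancelˡ-≤ D (begin
      D * (2 * D)   ≡⟨ *-swapˡ D 2 D ⟩
      2 * (D * D)   ≤⟨ *-monoʳ-≤ 2 D²≤SQ ⟩
      2 * (S * Q)   ≡⟨ *-swapˡ 2 S Q ⟩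
      S * (2 * Q)   ≤⟨ *-monoʳ-≤ S 2Q≤DS ⟩
      S * (D * S)   ≡⟨ *-swapˡ S D S ⟩
      D * (S * S)   ∎)
      where
      open ≤-Reasoning
      *-swapˡ : ∀ a b c → a * (b * c) ≡ b * (a * c)
      *-swapˡ = solve-∀

  degree≡deg+deg : ∀ (c r : Fin n → ℕ) → (∀ y → c y + r y ≡ 1) → ∀ x → degree x ≡ deg c x + deg r x
  degree≡deg+deg c r partition x = trans (sum-cong-≗ split) (∑-distrib-+ {n} _ _)
    where
    split : ∀ y → A x y ≡ c y * A x y + r y * A x y
    split y = trans (sym (*-identityˡ (A x y)))
                    (trans (cong (_* A x y) (sym (partition y))) (*-distribʳ-+ (A x y) (c y) (r y)))

  ∑deg≡∑w*degree : ∀ w → ∑[ x < n ] deg w x ≡ ∑[ y < n ] (w y * degree y)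
  ∑deg≡∑w*degree w = trans (∑-comm (λ x y → w y * A x y)) (sum-cong-≗ (λ y →
    trans (sum-cong-≗ (λ x → cong (w y *_) (A-sym x y))) (sym (*-distribˡ-sum (w y) (A y)))))

  ∑degree≤ : ∀ (c r : Fin n → ℕ) → (∀ y → c y + r y ≡ 1) → (∀ x → deg c x ≤ 2) →
             ∑[ x < n ] degree x ≤ n * 2 + (∑ r * 2 + degSum r)
  ∑degree≤ c r partition deg-c≤2 = begin
    ∑[ x < n ] degree x                                  ≡⟨ sum-cong-≗ (degree≡deg+deg c r partition) ⟩
    ∑[ x < n ] (deg c x + deg r x)                       ≡⟨ ∑-distrib-+ {n} _ _ ⟩
    ∑[ x < n ] deg c x + ∑[ x < n ] deg r x              ≤⟨ +-monoˡ-≤ _ (∑-mono-≤ deg-c≤2) ⟩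
    ∑[ x < n ] 2 + ∑[ x < n ] deg r x                    ≡⟨ cong₂ _+_ (∑-const n 2) (∑deg≡∑w*degree r) ⟩
    n * 2 + ∑[ y < n ] (r y * degree y)                  ≡⟨ cong (n * 2 +_) (sum-cong-≗ (λ y →
                                                           trans (cong (r y *_) (degree≡deg+deg c r partition y))
                                                                 (*-distribˡ-+ (r y) _ _))) ⟩
    n * 2 + ∑[ y < n ] (r y * deg c y + r y * deg r y)   ≤⟨ +-monoʳ-≤ (n * 2) (∑-mono-≤ (λ y →
                                                           +-monoˡ-≤ _ (*-monoʳ-≤ (r y) (deg-c≤2 y)))) ⟩
    n * 2 + ∑[ y < n ] (r y * 2 + r y * deg r y)         ≡⟨ cong (n * 2 +_) (trans (∑-distrib-+ {n} _ _)
                                                           (cong (_+ degSum r) (sym (*-distribʳ-sum 2 r)))) ⟩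
    n * 2 + (∑ r * 2 + degSum r)                         ∎
    where open ≤-Reasoning

  sparse-set-bound : TriangleFree G → (S : List (Fin n)) → Unique S → (∀ x → sum (map (A x) S) ≤ 2) →
                     ∃ λ R → n ≡ length S + R × 4 * numEdges G ≤ 4 * n + 4 * R + R * R
  sparse-set-bound triangle-free S unique sparse = ∑ r , n≡|S|+R , (begin
    4 * numEdges G                        ≡⟨ *-assoc 2 2 (numEdges G) ⟩
    2 * (2 * numEdges G)                  ≡⟨ cong (2 *_) ∑degree≡2*numEdges ⟨
    2 * ∑[ x < n ] degree x               ≤⟨ *-monoʳ-≤ 2 (∑degree≤ c r partition deg-c≤2) ⟩
    2 * (n * 2 + (∑ r * 2 + degSum r))    ≡⟨ expand n (∑ r) (degSum r) ⟩
    4 * n + 4 * ∑ r + 2 * degSum r        ≤⟨ +-monoʳ-≤ (4 * n + 4 * ∑ r) (mantel triangle-free r) ⟩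
    4 * n + 4 * ∑ r + ∑ r * ∑ r           ∎)
    where
    open ≤-Reasoning
    c r : Fin n → ℕ
    c y = χ (y ∈ᵇ S)
    r y = χ (not (y ∈ᵇ S))
    partition : ∀ y → c y + r y ≡ 1
    partition y = χ-not (y ∈ᵇ S)
    deg-c≤2 : ∀ x → deg c x ≤ 2
    deg-c≤2 x = subst (_≤ 2) (sym (∑-indicator-∈ unique (A x))) (sparse x)
    n≡|S|+R : n ≡ length S + ∑ r
    n≡|S|+R = begin-equality
      n                         ≡⟨ ∑-ones n ⟨
      ∑[ y < n ] 1              ≡⟨ sum-cong-≗ partition ⟨
      ∑[ y < n ] (c y + r y)    ≡⟨ ∑-distrib-+ {n} c r ⟩
      ∑ c + ∑ r                 ≡⟨ cong (_+ ∑ r) (∑-indicator-length unique) ⟩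
      length S + ∑ r            ∎
    expand : ∀ n r d → 2 * (n * 2 + (r * 2 + d)) ≡ 4 * n + 4 * r + 2 * d
    expand = solve-∀

  -- Shortest odd closed walks

  infixr 5 _∷_
  data Walk : ℕ → Fin n → Fin n → Set where
    []  : ∀ {x} → Walk 0 x x
    _∷_ : ∀ {k x y z} → Adj x y → Walk k y z → Walk (suc k) x z

  infixl 5 _∷ʳ_
  _∷ʳ_ : ∀ {k x y z} → Walk k x y → Adj y z → Walk (suc k) x z
  []       ∷ʳ e = e ∷ []
  (e′ ∷ W) ∷ʳ e = e′ ∷ (W ∷ʳ e)

  close : ∀ {k x y} → y ≡ x → Walk k x y → Walk k x x
  close refl W = W

  OddClosedWalk : ℕ → Set
  OddClosedWalk k = parity k ≡ 1ℙ × ∃ λ v → Walk k v v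

  adj⇒≢ : ∀ {x y} → Adj x y → x ≢ y
  adj⇒≢ xy refl = irrefl xy

  path₃⇒≢ : TriangleFree G → ∀ {a b c d} → Adj a b → Adj b c → Adj c d → a ≢ d
  path₃⇒≢ triangle-free ab bc cd refl = triangle-free _ _ _ ab bc (adj-sym cd)

  shortest-odd-closed-walk-prefix :
    TriangleFree G → ∀ {k w₀ w₁ w₂ w₃ w₄} →
    Adj w₀ w₁ → Adj w₁ w₂ → Adj w₂ w₃ → Adj w₃ w₄ → (rest : Walk (suc k) w₄ w₀) → parity (suc k) ≡ 1ℙ →
    (∀ {j} → j < 5 + k → ¬ OddClosedWalk j) →
    Unique (w₀ ∷ w₁ ∷ w₂ ∷ w₃ ∷ w₄ ∷ []) × (∀ x → sum (map (A x) (w₀ ∷ w₁ ∷ w₂ ∷ w₃ ∷ w₄ ∷ [])) ≤ 2)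
  shortest-odd-closed-walk-prefix triangle-free {k} {w₀} {w₁} {w₂} {w₃} {w₄} e₀ e₁ e₂ e₃ rest odd shortest =
    distinct , sparse
    where
    -- Closed walks of length 3 + k = L − 2 are odd and shorter than the shortest one.
    no-shortcut : ∀ {x} → Walk (3 + k) x x → ⊥
    no-shortcut W = shortest (n≤1+n (4 + k)) (odd , _ , W)
    distinct : Unique (w₀ ∷ w₁ ∷ w₂ ∷ w₃ ∷ w₄ ∷ [])
    distinct = (adj⇒≢ e₀ ∷ (λ e → no-shortcut (close e (e₂ ∷ e₃ ∷ rest)))
                         ∷ path₃⇒≢ triangle-free e₀ e₁ e₂
                         ∷ (λ e → shortest (m≤n+m (2 + k) 3) (odd , _ , close e rest)) ∷ [])
             ∷ (adj⇒≢ e₁ ∷ (λ e → no-shortcut (close e (e₃ ∷ (rest ∷ʳ e₀))))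
                         ∷ path₃⇒≢ triangle-free e₁ e₂ e₃ ∷ [])
             ∷ (adj⇒≢ e₂ ∷ (λ e → no-shortcut (close e (rest ∷ʳ e₀ ∷ʳ e₁))) ∷ [])
             ∷ (adj⇒≢ e₃ ∷ [])
             ∷ []
             ∷ []
    sparse : ∀ x → sum (map (A x) (w₀ ∷ w₁ ∷ w₂ ∷ w₃ ∷ w₄ ∷ [])) ≤ 2
    sparse x = five-cycle-sum≤2 (A x w₀) (A x w₁) (A x w₂) (A x w₃) (A x w₄)
                                (A+A≤1 (λ xw₀ xw₁ → triangle-free x w₀ w₁ xw₀ e₀ xw₁))
                                (A+A≤1 (λ xw₁ xw₂ → triangle-free x w₁ w₂ xw₁ e₁ xw₂))
                                (A+A≤1 (λ xw₂ xw₃ → triangle-free x w₂ w₃ xw₂ e₂ xw₃))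
                                (A+A≤1 (λ xw₃ xw₄ → triangle-free x w₃ w₄ xw₃ e₃ xw₄))
                                (A+A≤1 (λ xw₄ xw₀ → no-shortcut (xw₄ ∷ (rest ∷ʳ adj-sym xw₀))))

  shortest-odd-closed-walk⇒sparse-five-set :
    TriangleFree G → ∀ {L v} → Walk L v v → parity L ≡ 1ℙ → (∀ {j} → j < L → ¬ OddClosedWalk j) →
    ∃ λ S → Unique S × length S ≡ 5 × (∀ x → sum (map (A x) S) ≤ 2)
  shortest-odd-closed-walk⇒sparse-five-set triangle-free (e ∷ []) _ _ = ⊥-elim (irrefl e)
  shortest-odd-closed-walk⇒sparse-five-set triangle-free (e₀ ∷ e₁ ∷ e₂ ∷ []) _ _ =
    ⊥-elim (triangle-free _ _ _ e₀ e₁ (adj-sym e₂))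
  shortest-odd-closed-walk⇒sparse-five-set triangle-free (e₀ ∷ e₁ ∷ e₂ ∷ e₃ ∷ rest@(_ ∷ _)) odd shortest
    with distinct , sparse ← shortest-odd-closed-walk-prefix triangle-free e₀ e₁ e₂ e₃ rest odd shortest =
    _ , distinct , refl , sparse

  odd-closed-walk-bound : TriangleFree G → ∀ m → n ≤ 1 + 2 * m → ∃ OddClosedWalk → numEdges G ≤ 1 + m * m
  odd-closed-walk-bound triangle-free m n≤1+2m (_ , odd-walk) =
    by-minimal-witness (numEdges G ≤? 1 + m * m) shortest⇒bound odd-walk
    where
    shortest⇒bound : ∀ {L} → OddClosedWalk L → (∀ {j} → j < L → ¬ OddClosedWalk j) → numEdges G ≤ 1 + m * m
    shortest⇒bound (odd , _ , W) shortest
      with S , unique , |S|≡5 , sparse ← shortest-odd-closed-walk⇒sparse-five-set triangle-free W odd shortest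
      with R , n≡|S|+R , 4e≤ ← sparse-set-bound triangle-free S unique sparse
      = quadratic-bound {m = m} 4e≤ (trans n≡|S|+R (cong (_+ R) |S|≡5)) n≤1+2m

  -- Matchings

  mate : ∀ (M : List (Fin n × Fin n)) {x} → x ∈ verts G M → Fin n
  mate ((_ , q) ∷ M) (here _)          = q
  mate ((p , _) ∷ M) (there (here _))  = p
  mate (_ ∷ M)       (there (there i)) = mate M i

  mate-adj : ∀ {M} → All (λ p → Adj (proj₁ p) (proj₂ p)) M → ∀ {x} (i : x ∈ verts G M) → Adj x (mate M i)
  mate-adj (pq ∷ _)      (here refl)         = pq
  mate-adj (pq ∷ _)      (there (here refl)) = adj-sym pq
  mate-adj (_ ∷ all-adj) (there (there i))   = mate-adj all-adj i

  mate∈ : ∀ M {x} (i : x ∈ verts G M) → mate M i ∈ verts G M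
  mate∈ (_ ∷ _) (here _)          = there (here refl)
  mate∈ (_ ∷ _) (there (here _))  = here refl
  mate∈ (_ ∷ M) (there (there i)) = there (there (mate∈ M i))

  mate-mate : ∀ M {x} (i : x ∈ verts G M) → mate M (mate∈ M i) ≡ x
  mate-mate (_ ∷ _) (here refl)         = refl
  mate-mate (_ ∷ _) (there (here refl)) = refl
  mate-mate (_ ∷ M) (there (there i))   = mate-mate M i

  mate-injective : ∀ M {x y} → Unique (verts G M) → (i : x ∈ verts G M) (j : y ∈ verts G M) →
                   mate M i ≡ mate M j → x ≡ y
  mate-injective M {x} {y} unique i j mate-i≡mate-j = begin
    x                     ≡⟨ mate-mate M i ⟨
    mate M (mate∈ M i)    ≡⟨ mate-cong mate-i≡mate-j (mate∈ M i) (mate∈ M j) ⟩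
    mate M (mate∈ M j)    ≡⟨ mate-mate M j ⟩
    y                     ∎
    where
    open ≡-Reasoning
    mate-cong : ∀ {a b} → a ≡ b → (i : a ∈ verts G M) (j : b ∈ verts G M) → mate M i ≡ mate M j
    mate-cong refl i j = cong (mate M)
      (SetoidMembership.unique⇒irrelevant (setoid (Fin n)) (Decidable⇒UIP.≡-irrelevant _≟_) unique i j)

  length-verts : ∀ M → length (verts G M) ≡ 2 * length M
  length-verts []      = refl
  length-verts (_ ∷ M) = trans (cong (2 +_) (length-verts M)) (sym (*-suc 2 (length M)))

  perfect-matching-minus⇒order≤ : ∀ {u M} → IsPerfectMatchingMinus G u M → n ≤ 1 + 2 * length M
  perfect-matching-minus⇒order≤ {u} {M} ((_ , unique) , u∉M , covered) = begin
    n                                      ≡⟨ ∑-ones n ⟨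
    ∑[ y < n ] 1                           ≤⟨ ∑-mono-≤ (λ y → ≤-reflexive (cong χ (sym (∈⇒∈ᵇ (u∷M-covers y))))) ⟩
    ∑[ y < n ] χ (y ∈ᵇ (u ∷ verts G M))    ≡⟨ ∑-indicator-length (¬Any⇒All¬ _ u∉M ∷ unique) ⟩
    1 + length (verts G M)                 ≡⟨ cong suc (length-verts M) ⟩
    1 + 2 * length M                       ∎
    where
    open ≤-Reasoning
    u∷M-covers : ∀ y → y ∈ u ∷ verts G M
    u∷M-covers y with y ≟ u
    ... | yes refl = here refl
    ... | no y≢u   = there (covered y y≢u)

  factor-critical⇒order≤ : FactorCritical G → Fin n → ∀ {M} → IsMaximumMatching G M → n ≤ 1 + 2 * length M
  factor-critical⇒order≤ factor-critical u (_ , maximum) with Mu , perfect-u ← factor-critical u =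
    ≤-trans (perfect-matching-minus⇒order≤ perfect-u) (+-monoʳ-≤ 1 (*-monoʳ-≤ 2 (maximum Mu (proj₁ perfect-u))))

  -- The alternating orbit x ↦ mate_u (mate_w x) starting at u never revisits a vertex: the map is
  -- injective and u is not covered by M_u. So within n steps it reaches w, or some mate_w x is u;
  -- either way an edge back to u closes an odd walk.
  module _ {u w : Fin n} (uw : Adj u w) {Mu Mw : List (Fin n × Fin n)}
           (perfect-u : IsPerfectMatchingMinus G u Mu) (perfect-w : IsPerfectMatchingMinus G w Mw) where

    private
      matching-u : IsMatching G Mu
      matching-u = proj₁ perfect-u
      matching-w : IsMatching G Mw
      matching-w = proj₁ perfect-w

    data Orbit : ℕ → Fin n → List (Fin n) → Set where
      start : Orbit 0 u []
      step  : ∀ {k x vs} → Orbit k x vs → (i : x ∈ verts G Mw) (j : mate Mw i ∈ verts G Mu) →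
              Orbit (2 + k) (mate Mu j) (x ∷ vs)

    orbit-walk : ∀ {k x vs} → Orbit k x vs → Walk k x u
    orbit-walk start        = []
    orbit-walk (step o i j) =
      adj-sym (mate-adj (proj₁ matching-u) j) ∷ adj-sym (mate-adj (proj₁ matching-w) i) ∷ orbit-walk o

    orbit-even : ∀ {k x vs} → Orbit k x vs → parity k ≡ 0ℙ
    orbit-even start        = refl
    orbit-even (step o _ _) = orbit-even o

    orbit-close : ∀ {k x vs} → Orbit k x vs → Adj u x → ∃ OddClosedWalk
    orbit-close {k} o ux = suc k , parity-suc-even {k} (orbit-even o) , _ , ux ∷ orbit-walk o

    orbit-predecessor : ∀ {k x vs z} → Orbit k x vs → z ∈ x ∷ vs →
      z ≡ u ⊎ ∃ λ z₀ → z₀ ∈ vs × Σ (z₀ ∈ verts G Mw) λ i → Σ (mate Mw i ∈ verts G Mu) λ j → mate Mu j ≡ z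
    orbit-predecessor start                (here refl) = inj₁ refl
    orbit-predecessor (step {x = x} o i j) (here refl) = inj₂ (x , here refl , i , j , refl)
    orbit-predecessor (step o i j)         (there z∈) with orbit-predecessor o z∈
    ... | inj₁ z≡u                      = inj₁ z≡u
    ... | inj₂ (z₀ , z₀∈ , i₀ , j₀ , e) = inj₂ (z₀ , there z₀∈ , i₀ , j₀ , e)

    orbit-fresh : ∀ {k x vs} → Orbit k x vs → Unique (x ∷ vs) →
                  (i : x ∈ verts G Mw) (j : mate Mw i ∈ verts G Mu) → mate Mu j ∉ x ∷ vs
    orbit-fresh {x = x} {vs} o unique i j x′∈ with orbit-predecessor o x′∈
    ... | inj₁ x′≡u = proj₁ (proj₂ perfect-u) (subst (_∈ verts G Mu) x′≡u (mate∈ Mu j))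
    ... | inj₂ (z₀ , z₀∈vs , i₀ , j₀ , e) = Unique[x∷xs]⇒x∉xs unique (subst (_∈ vs) z₀≡x z₀∈vs)
      where
      z₀≡x : z₀ ≡ x
      z₀≡x = mate-injective Mw (proj₂ matching-w) i₀ i (mate-injective Mu (proj₂ matching-u) j₀ j e)

    explore : ∀ fuel {k x vs} → Orbit k x vs → Unique (x ∷ vs) → n ≤ length vs + fuel → ∃ OddClosedWalk
    explore zero {vs = vs} _ unique n≤ =
      ⊥-elim (n≮n (length vs) (≤-trans (unique-length≤ unique) (≤-trans n≤ (≤-reflexive (+-identityʳ _)))))
    explore (suc fuel) {x = x} o unique n≤ with x ≟ w
    ... | yes refl = orbit-close o uw
    ... | no x≢w   = continue (proj₂ (proj₂ perfect-w) x x≢w)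
      where
      continue : x ∈ verts G Mw → ∃ OddClosedWalk
      continue i with mate Mw i ≟ u
      ... | yes y≡u = orbit-close o (adj-sym (subst (Adj x) y≡u (mate-adj (proj₁ matching-w) i)))
      ... | no y≢u  = explore fuel (step o i j) (¬Any⇒All¬ _ (orbit-fresh o unique i j) ∷ unique)
                              (subst (n ≤_) (+-suc _ fuel) n≤)
        where
        j : mate Mw i ∈ verts G Mu
        j = proj₂ (proj₂ perfect-u) (mate Mw i) y≢u

    odd-closed-walk : ∃ OddClosedWalk
    odd-closed-walk = explore n start ([] ∷ []) ≤-refl

  factor-critical⇒odd-closed-walk : FactorCritical G → ∀ {u w} → Adj u w → ∃ OddClosedWalk
  factor-critical⇒odd-closed-walk factor-critical {u} {w} uw =
    odd-closed-walk uw (proj₂ (factor-critical u)) (proj₂ (factor-critical w))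

lemma4 : (H : Graph) → FactorCritical H → TriangleFree H →
         (M : List (Fin (Graph.n H) × Fin (Graph.n H))) → IsMaximumMatching H M →
         numEdges H ≤ 1 + length M * length M
lemma4 H factor-critical triangle-free M maximum with 0 <? numEdges H
... | no no-edge   = ≤-trans (≮⇒≥ no-edge) z≤n
... | yes has-edge with u , w , uw ← edge-exists H has-edge =
  odd-closed-walk-bound H triangle-free (length M) (factor-critical⇒order≤ H factor-critical u maximum)
                        (factor-critical⇒odd-closed-walk H factor-critical uw)
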